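{- For every integer $n\ge 4$, $$\beta_b(C(n;1,2))=\begin{cases}\alpha(C(n;1,2))=1, & \text{if } n\in\{4,5\},\\ \dfrac{n-3}{2}, & \text{if } n\equiv 9 \pmod{12},\\ 2(\mathrm{diam}(C(n;1,2))-1)=2\left(\left\lceil\dfrac{n-1}{4}\right\rceil-1\right), & \text{otherwise.}\end{cases}$$
   Context: For integers $n\ge 3$ and $1\le a\le\lfloor n/2\rfloor$, the circulant graph $C(n;1,a)$ has vertex set $\{v_0,\dots,v_{n-1}\}$ and edges $v_iv_{i+1}$ and $v_iv_{i+a}$, subscripts modulo $n$. For a connected graph $G$, $\mathrm{diam}(G)$ is its diameter; a broadcast is a function $f:V(G)\to\{0,\dots,\mathrm{diam}(G)\}$ with $f(v)\le e(v)$ (eccentricity) for all $v$; $V_f^+=\{v:f(v)>0\}$. $f$ is independent if $d(u,v)>\max\{f(u),f(v)\}$ for all distinct $u,v\in V_f^+$. The cost is $\sigma(f)=\sum_v f(v)$, and $\beta_b(G)$ is the maximum cost of an independent broadcast on $G$. $\alpha(G)$ denotes the independence number. -}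

module Defs where

open import Data.Nat using (ℕ; zero; suc; _+_; _≤_; _<_; _⊔_)
open import Data.Fin using (Fin; toℕ)
open import Data.Nat.ListAction using (sum)
open import Data.List using (List; map; allFin; length; filter)
open import Data.Bool using (Bool; true; false; T)
open import Data.Product using (Σ; ∃; _×_; _,_)
open import Data.Sum using (_⊎_)
open import Relation.Nullary using (¬_)
open import Relation.Binary.PropositionalEquality using (_≡_; _≢_)

-- j = i + s (mod n), for i j : Fin n and s < n
Shift : (n : ℕ) → Fin n → Fin n → ℕ → Set
Shift n i j s = (toℕ j ≡ toℕ i + s) ⊎ (toℕ j + n ≡ toℕ i + s)

Adj : (n : ℕ) → Fin n → Fin n → Set
Adj n i j = Shift n i j 1 ⊎ Shift n i j 2 ⊎ Shift n j i 1 ⊎ Shift n j i 2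

data Walk (n : ℕ) : Fin n → Fin n → ℕ → Set where
  here : ∀ {u} → Walk n u u 0
  step : ∀ {u w v k} → Adj n u w → Walk n w v k → Walk n u v (suc k)

Dist : (n : ℕ) → Fin n → Fin n → ℕ → Set
Dist n u v k = Walk n u v k × (∀ m → m < k → ¬ Walk n u v m)

IsEcc : (n : ℕ) → Fin n → ℕ → Set
IsEcc n v e = (∃ λ u → Dist n v u e) × (∀ u k → Dist n v u k → k ≤ e)

IsDiam : (n : ℕ) → ℕ → Set
IsDiam n d = (∃ λ v → IsEcc n v d) × (∀ v e → IsEcc n v e → e ≤ d)

IsBroadcast : (n : ℕ) → (Fin n → ℕ) → Set
IsBroadcast n f = ∀ v e → IsEcc n v e → f v ≤ e

IsIndependent : (n : ℕ) → (Fin n → ℕ) → Set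
IsIndependent n f = ∀ u v → u ≢ v → 0 < f u → 0 < f v →
  ∀ k → Dist n u v k → (f u ⊔ f v) < k

cost : (n : ℕ) → (Fin n → ℕ) → ℕ
cost n f = sum (map f (allFin n))

IsBroadcastIndependenceNumber : (n : ℕ) → ℕ → Set
IsBroadcastIndependenceNumber n m =
  (∃ λ f → IsBroadcast n f × IsIndependent n f × cost n f ≡ m) ×
  (∀ f → IsBroadcast n f → IsIndependent n f → cost n f ≤ m)

IsIndepSet : (n : ℕ) → (Fin n → Bool) → Set
IsIndepSet n S = ∀ u v → S u ≡ true → S v ≡ true → ¬ Adj n u v

size : (n : ℕ) → (Fin n → Bool) → ℕ
size n S = length (filter (λ v → Data.Bool._≟_ (S v) true) (allFin n))

IsIndependenceNumber : (n : ℕ) → ℕ → Set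
IsIndependenceNumber n m =
  (∃ λ S → IsIndepSet n S × size n S ≡ m) ×
  (∀ S → IsIndepSet n S → size n S ≤ m)

{-# OPTIONS --safe #-}
-- The vertex v_j lies at distance ⌈m/2⌉ from v_i, where m = min(t, n − t) for t ≡ j − i (mod n):
-- a walk of length k moves at most 2k around the cycle, and steps of 2 achieve this. Hence every
-- vertex has eccentricity D = ⌈(n − 1)/4⌉ = ⌊(n + 2)/4⌋, a broadcast is any f ≤ D, and f is
-- independent iff broadcasting positions i < j satisfy 2 max(f i, f j) < min(j − i, n − j + i).
-- For n ∈ {4, 5} we get D = 1, so the graph is complete and α = 1.
--
-- Adding up these gaps around the cycle gives 2σ + k + 2e ≤ n for k ≥ 2 broadcasting vertices of
-- total cost σ, where e is the total rise of the values around the cycle, so e = 0 only if all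
-- values are equal; for k ≤ 1 simply σ ≤ D. This gives σ ≤ 1 for n ∈ {4, 5} and σ ≤ (n − 3)/2 for
-- n ≡ 9 (mod 12). Otherwise σ ≥ 2D − 1 would force σ = 2D − 1, e = 0 and k ≤ 3; as σ is odd, k = 3
-- and σ = 3a with a odd, whence n = 2σ + 3 = 6a + 3 ≡ 9 (mod 12).
--
-- The bounds are attained by k vertices h apart, each broadcasting c, where 2c < h and kh ≤ n: one
-- vertex with c = 1; two with c = D − 1 and h = 2D − 1; three with c = (n − 3)/6 and h = n/3.
module Submission where

open import Data.Bool as Bool using (Bool; true; false)
open import Data.Empty using (⊥-elim)
open import Data.Fin as Fin using (Fin; toℕ; fromℕ<)
open import Data.Fin.Properties using (toℕ-injective; toℕ<n; toℕ-fromℕ<)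
open import Data.List using (List; []; _∷_; length; filter; tabulate)
open import Data.List.Properties using (filter-none; map-tabulate)
import Data.List.Relation.Unary.All as All
open import Data.List.Relation.Unary.All.Properties using (tabulate⁺)
import Data.List.Relation.Unary.AllPairs as AllPairs
open import Data.List.Relation.Unary.Unique.Propositional using (Unique)
open import Data.List.Relation.Unary.Unique.Propositional.Properties using (allFin⁺)
open import Data.Nat
open import Data.Nat.DivMod
open import Data.Nat.ListAction using (sum)
open import Data.Nat.Properties
open import Algebra.Properties.CommutativeSemigroup +-commutativeSemigroup
  using (xy∙z≈xz∙y; xy∙z≈x∙zy; x∙yz≈y∙xz) renaming (interchange to +-interchange)
open import Data.Nat.Tactic.RingSolver using (solve; solve-∀)
open import Data.Product as Product using (∃; ∃₂; _×_; _,_; proj₁; proj₂)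
open import Data.Sum as Sum using (_⊎_; inj₁; inj₂; [_,_]′)
open import Function using (_∘_; id)
open import Relation.Binary.PropositionalEquality
open import Relation.Binary using (tri<; tri≈; tri>)
open import Relation.Unary using (Decidable)
open import Relation.Nullary using (¬_; yes; no)
open import Defs

m≤n+n⇒⌈m/2⌉≤n : ∀ {m n} → m ≤ n + n → ⌈ m /2⌉ ≤ n
m≤n+n⇒⌈m/2⌉≤n {n = n} m≤2n = ≤-trans (⌈n/2⌉-mono m≤2n) (≤-reflexive (sym (n≡⌈n+n/2⌉ n)))

n+n<m⇒n<⌈m/2⌉ : ∀ {m n} → n + n < m → n < ⌈ m /2⌉
n+n<m⇒n<⌈m/2⌉ {n = n} 2n<m = ≤-trans (≤-reflexive (cong suc (n≡⌊n+n/2⌋ n))) (⌈n/2⌉-mono 2n<m)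

n<⌈m/2⌉⇒n+n<m : ∀ {m n} → n < ⌈ m /2⌉ → n + n < m
n<⌈m/2⌉⇒n+n<m {m} {n} n<⌈m/2⌉ with n + n <? m
... | yes 2n<m = 2n<m
... | no 2n≮m = ⊥-elim (<⇒≱ n<⌈m/2⌉ (m≤n+n⇒⌈m/2⌉≤n (≮⇒≥ 2n≮m)))

⌈1+n+n/2⌉≡1+n : ∀ n → ⌈ suc (n + n) /2⌉ ≡ suc n
⌈1+n+n/2⌉≡1+n n = cong suc (sym (n≡⌊n+n/2⌋ n))

m+m≤n+n+1⇒m≤n : ∀ {m n} → m + m ≤ n + n + 1 → m ≤ n
m+m≤n+n+1⇒m≤n {m} {n} m+m≤2n+1 with m ≤? n
... | yes m≤n = m≤n
... | no m≰n = ⊥-elim (<⇒≱ 2n+1<m+m m+m≤2n+1)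
  where
  2n+1<m+m : n + n + 1 < m + m
  2n+1<m+m = ≤-trans (≤-reflexive (cong suc (trans (+-assoc n n 1) (cong (n +_) (+-comm n 1)))))
                     (+-mono-≤ (≰⇒> m≰n) (≰⇒> m≰n))

m⊔n≡m+[n∸m] : ∀ m n → m ⊔ n ≡ m + (n ∸ m)
m⊔n≡m+[n∸m] zero    n       = refl
m⊔n≡m+[n∸m] (suc m) zero    = sym (+-identityʳ (suc m))
m⊔n≡m+[n∸m] (suc m) (suc n) = cong suc (m⊔n≡m+[n∸m] m n)

m≤n≤1+m : ∀ {m n} → m ≤ n → n ≤ suc m → n ≡ m ⊎ n ≡ suc m
m≤n≤1+m m≤n n≤1+m with m≤n⇒m<n∨m≡n m≤n
... | inj₁ m<n = inj₂ (≤-antisym n≤1+m m<n)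
... | inj₂ m≡n = inj₁ (sym m≡n)

odd≢even : ∀ p q → suc (p + p) ≢ q + q
odd≢even zero    zero    ()
odd≢even zero    (suc q) 1≡2+2q = 0≢1+n (trans (suc-injective 1≡2+2q) (+-suc q q))
odd≢even (suc p) zero    ()
odd≢even (suc p) (suc q) eq rewrite +-suc p p | +-suc q q = odd≢even p q (suc-injective (suc-injective eq))

-- Congruence modulo n

infix 4 _≡_[mod_]

_≡_[mod_] : ℕ → ℕ → ℕ → Set
a ≡ b [mod n ] = ∃₂ λ x y → a + x * n ≡ b + y * n

≡⇒≡mod : ∀ {n a b} → a ≡ b → a ≡ b [mod n ]
≡⇒≡mod a≡b = 0 , 0 , cong (_+ 0) a≡b

≡mod-sym : ∀ {n a b} → a ≡ b [mod n ] → b ≡ a [mod n ]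
≡mod-sym (x , y , eq) = y , x , sym eq

≡mod-trans : ∀ {n a b c} → a ≡ b [mod n ] → b ≡ c [mod n ] → a ≡ c [mod n ]
≡mod-trans {n} {a} {b} {c} (x , y , a≡b) (x′ , y′ , b≡c) = x + x′ , y′ + y , (begin
  a + (x + x′) * n    ≡⟨ solve (a ∷ x ∷ x′ ∷ n ∷ []) ⟩
  a + x * n + x′ * n  ≡⟨ cong (_+ x′ * n) a≡b ⟩
  b + y * n + x′ * n  ≡⟨ solve (b ∷ y ∷ x′ ∷ n ∷ []) ⟩
  b + x′ * n + y * n  ≡⟨ cong (_+ y * n) b≡c ⟩
  c + y′ * n + y * n  ≡⟨ solve (c ∷ y′ ∷ y ∷ n ∷ []) ⟩
  c + (y′ + y) * n    ∎)
  where open ≡-Reasoning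

≡mod-+ʳ : ∀ {n a b} c → a ≡ b [mod n ] → a + c ≡ b + c [mod n ]
≡mod-+ʳ {n} {a} {b} c (x , y , eq) = x , y , (begin
  a + c + x * n  ≡⟨ solve (a ∷ c ∷ x ∷ n ∷ []) ⟩
  a + x * n + c  ≡⟨ cong (_+ c) eq ⟩
  b + y * n + c  ≡⟨ solve (b ∷ y ∷ c ∷ n ∷ []) ⟩
  b + c + y * n  ∎)
  where open ≡-Reasoning

≡mod-+ˡ : ∀ {n a b} c → a ≡ b [mod n ] → c + a ≡ c + b [mod n ]
≡mod-+ˡ {a = a} {b} c a≡b =
  ≡mod-trans (≡⇒≡mod (+-comm c a)) (≡mod-trans (≡mod-+ʳ c a≡b) (≡⇒≡mod (+-comm b c)))

≡mod-cancelˡ : ∀ {n} c {a b} → c + a ≡ c + b [mod n ] → a ≡ b [mod n ]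
≡mod-cancelˡ c {a} {b} (x , y , eq) =
  x , y , +-cancelˡ-≡ c _ _ (trans (sym (+-assoc c a _)) (trans eq (+-assoc c b _)))

≡mod-+-modulus : ∀ m n → m + n ≡ m [mod n ]
≡mod-+-modulus m n = 0 , 1 , solve (m ∷ n ∷ [])

%≡mod : ∀ a n .{{_ : NonZero n}} → a % n ≡ a [mod n ]
%≡mod a n = a / n , 0 , trans (sym (m≡m%n+[m/n]*n a n)) (sym (+-identityʳ a))

≡mod⇒%≡ : ∀ {n a b} .{{_ : NonZero n}} → a ≡ b [mod n ] → a % n ≡ b % n
≡mod⇒%≡ {n} {a} {b} (x , y , eq) = begin
  a % n            ≡⟨ sym ([m+kn]%n≡m%n a x n) ⟩
  (a + x * n) % n  ≡⟨ cong (_% n) eq ⟩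
  (b + y * n) % n  ≡⟨ [m+kn]%n≡m%n b y n ⟩
  b % n            ∎
  where open ≡-Reasoning

≡mod⇒≡ : ∀ {n a b} → a < n → b < n → a ≡ b [mod n ] → a ≡ b
≡mod⇒≡ {suc _} a<n b<n a≡b =
  trans (sym (m<n⇒m%n≡m a<n)) (trans (≡mod⇒%≡ a≡b) (m<n⇒m%n≡m b<n))

≡mod⇒≡⊎+n≡ : ∀ {n a b} → a < n → b < n + n → a ≡ b [mod n ] → a ≡ b ⊎ a + n ≡ b
≡mod⇒≡⊎+n≡ {n} {a} {b} a<n b<2n a≡b with b <? n
... | yes b<n = inj₁ (≡mod⇒≡ a<n b<n a≡b)
... | no b≮n = inj₂ (trans (cong (_+ n) a≡b-n) (m∸n+n≡m n≤b))
  where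
  n≤b : n ≤ b
  n≤b = ≮⇒≥ b≮n
  b-n<n : b ∸ n < n
  b-n<n = ≤-trans (∸-monoˡ-< b<2n n≤b) (≤-reflexive (m+n∸n≡m n n))
  a≡b-n : a ≡ b ∸ n
  a≡b-n = ≡mod⇒≡ a<n b-n<n
    (≡mod-trans a≡b (≡mod-trans (≡⇒≡mod (sym (m∸n+n≡m n≤b))) (≡mod-+-modulus (b ∸ n) n)))

-- Distances in C(n;1,2)

-- b is reached from a by p steps forward and q steps backward around the n-cycle, with p + q ≤ X.
Near : ℕ → ℕ → ℕ → ℕ → Set
Near n X a b = ∃₂ λ p q → p + q ≤ X × a + p ≡ b + q [mod n ]

near-refl : ∀ {n a} → Near n 0 a a
near-refl = 0 , 0 , z≤n , ≡⇒≡mod refl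

near-mono : ∀ {n a b X Y} → X ≤ Y → Near n X a b → Near n Y a b
near-mono X≤Y (p , q , p+q≤X , eq) = p , q , ≤-trans p+q≤X X≤Y , eq

near-trans : ∀ {n a b c X Y} → Near n X a b → Near n Y b c → Near n (X + Y) a c
near-trans {n} {a} {b} {c} (p , q , p+q≤X , a+p≡b+q) (p′ , q′ , p′+q′≤Y , b+p′≡c+q′) =
  p + p′ , q + q′ , ≤-trans (≤-reflexive (+-interchange p p′ q q′)) (+-mono-≤ p+q≤X p′+q′≤Y) ,
  ≡mod-trans (≡⇒≡mod (sym (+-assoc a p p′)))
  (≡mod-trans (≡mod-+ʳ p′ a+p≡b+q)
  (≡mod-trans (≡⇒≡mod (xy∙z≈xz∙y b q p′))
  (≡mod-trans (≡mod-+ʳ q b+p′≡c+q′)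
  (≡⇒≡mod (xy∙z≈x∙zy c q′ q)))))

shift⇒≡mod : ∀ {n s} (i j : Fin n) → Shift n i j s → toℕ i + s ≡ toℕ j [mod n ]
shift⇒≡mod i j (inj₁ j≡i+s) = ≡⇒≡mod (sym j≡i+s)
shift⇒≡mod {n} i j (inj₂ j+n≡i+s) = ≡mod-trans (≡⇒≡mod (sym j+n≡i+s)) (≡mod-+-modulus (toℕ j) n)

shift⇒near : ∀ {n s} (i j : Fin n) → Shift n i j s → Near n s (toℕ i) (toℕ j)
shift⇒near {s = s} i j i→j =
  s , 0 , ≤-reflexive (+-identityʳ s) , ≡mod-trans (shift⇒≡mod i j i→j) (≡⇒≡mod (sym (+-identityʳ _)))

shift⇒near⁻ : ∀ {n s} (i j : Fin n) → Shift n j i s → Near n s (toℕ i) (toℕ j)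
shift⇒near⁻ {s = s} i j j→i =
  0 , s , ≤-refl , ≡mod-trans (≡⇒≡mod (+-identityʳ _)) (≡mod-sym (shift⇒≡mod j i j→i))

adj⇒near : ∀ {n} (u w : Fin n) → Adj n u w → Near n 2 (toℕ u) (toℕ w)
adj⇒near u w (inj₁ u→w)               = near-mono (s≤s z≤n) (shift⇒near u w u→w)
adj⇒near u w (inj₂ (inj₁ u→w))        = shift⇒near u w u→w
adj⇒near u w (inj₂ (inj₂ (inj₁ w→u))) = near-mono (s≤s z≤n) (shift⇒near⁻ u w w→u)
adj⇒near u w (inj₂ (inj₂ (inj₂ w→u))) = shift⇒near⁻ u w w→u

walk⇒near : ∀ {n k} {u v : Fin n} → Walk n u v k → Near n (k + k) (toℕ u) (toℕ v)
walk⇒near here = near-refl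
walk⇒near {k = suc k} {u} (step {w = w} u~w w⇝v) =
  near-mono (≤-reflexive (cong suc (sym (+-suc k k)))) (near-trans (adj⇒near u w u~w) (walk⇒near w⇝v))

≡mod-offset≤ : ∀ {n t p q} → t < n → p ≡ t + q [mod n ] → t ≤ p + q ⊎ n ∸ t ≤ p + q
≡mod-offset≤ {n} {t} {p} {q} t<n p≡t+q with p <? n | q <? n
... | no p≮n | _ = inj₁ (≤-trans (<⇒≤ t<n) (≤-trans (≮⇒≥ p≮n) (m≤m+n p q)))
... | yes _ | no q≮n = inj₁ (≤-trans (<⇒≤ t<n) (≤-trans (≮⇒≥ q≮n) (m≤n+m q p)))
... | yes p<n | yes q<n with ≡mod⇒≡⊎+n≡ p<n (+-mono-< t<n q<n) p≡t+q
...   | inj₁ p≡t+q = inj₁ (≤-trans (m≤m+n t q) (≤-trans (≤-reflexive (sym p≡t+q)) (m≤m+n p q)))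
...   | inj₂ p+n≡t+q =
  inj₂ (≤-trans (m≤n+o⇒m∸n≤o n t (≤-trans (m≤n+m n p) (≤-reflexive p+n≡t+q))) (m≤n+m q p))

near⇒offset≤ : ∀ {n a b t X} → t < n → b ≡ a + t [mod n ] → Near n X a b → t ⊓ (n ∸ t) ≤ X
near⇒offset≤ {n} {a} {b} {t} t<n b≡a+t (p , q , p+q≤X , a+p≡b+q) =
  ≤-trans ([ ≤-trans (m⊓n≤m t (n ∸ t)) , ≤-trans (m⊓n≤n t (n ∸ t)) ]′ (≡mod-offset≤ t<n p≡t+q)) p+q≤X
  where
  p≡t+q : p ≡ t + q [mod n ]
  p≡t+q = ≡mod-cancelˡ a (≡mod-trans a+p≡b+q (≡mod-trans (≡mod-+ʳ q b≡a+t) (≡⇒≡mod (+-assoc a t q))))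

shift-exists : ∀ {n} (u : Fin n) s → s ≤ n → ∃ λ w → Shift n u w s
shift-exists {suc n} u s s≤n =
  w , ≡mod⇒≡⊎+n≡ (toℕ<n w) (+-mono-<-≤ (toℕ<n u) s≤n)
        (≡mod-trans (≡⇒≡mod (toℕ-fromℕ< _)) (%≡mod (toℕ u + s) (suc n)))
  where
  w : Fin (suc n)
  w = fromℕ< (m%n<n (toℕ u + s) (suc n))

walk-forward : ∀ {n} → 2 ≤ n → ∀ t {u v : Fin n} → toℕ v ≡ toℕ u + t [mod n ] → Walk n u v ⌈ t /2⌉
walk-forward 2≤n zero {u} {v} v≡u+0 =
  subst (λ w → Walk _ u w 0)
    (toℕ-injective (≡mod⇒≡ (toℕ<n u) (toℕ<n v) (≡mod-sym (≡mod-trans v≡u+0 (≡⇒≡mod (+-identityʳ _))))))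
    here
walk-forward 2≤n 1 {u} {v} v≡u+1 =
  step (inj₁ (≡mod⇒≡⊎+n≡ (toℕ<n v) (+-mono-<-≤ (toℕ<n u) (≤-trans (s≤s z≤n) 2≤n)) v≡u+1)) here
walk-forward 2≤n (suc (suc t)) {u} {v} v≡u+2+t with shift-exists u 2 2≤n
... | w , u→w = step (inj₂ (inj₁ u→w)) (walk-forward 2≤n t v≡w+t)
  where
  v≡w+t : toℕ v ≡ toℕ w + t [mod _ ]
  v≡w+t = ≡mod-trans v≡u+2+t
    (≡mod-trans (≡⇒≡mod (sym (+-assoc (toℕ u) 2 t))) (≡mod-+ʳ t (shift⇒≡mod u w u→w)))

adj-sym : ∀ {n} {u v : Fin n} → Adj n u v → Adj n v u
adj-sym (inj₁ u→v)               = inj₂ (inj₂ (inj₁ u→v))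
adj-sym (inj₂ (inj₁ u→v))        = inj₂ (inj₂ (inj₂ u→v))
adj-sym (inj₂ (inj₂ (inj₁ v→u))) = inj₁ v→u
adj-sym (inj₂ (inj₂ (inj₂ v→u))) = inj₂ (inj₁ v→u)

walk-snoc : ∀ {n k} {u v w : Fin n} → Walk n u v k → Adj n v w → Walk n u w (suc k)
walk-snoc here v~w = step v~w here
walk-snoc (step u~u′ u′⇝v) v~w = step u~u′ (walk-snoc u′⇝v v~w)

walk-reverse : ∀ {n k} {u v : Fin n} → Walk n u v k → Walk n v u k
walk-reverse here = here
walk-reverse (step u~w w⇝v) = walk-snoc (walk-reverse w⇝v) (adj-sym u~w)

offset-reverse : ∀ {n a b t} → t ≤ n → b ≡ a + t [mod n ] → a ≡ b + (n ∸ t) [mod n ]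
offset-reverse {n} {a} {b} {t} t≤n b≡a+t = ≡mod-sym
  (≡mod-trans (≡mod-+ʳ (n ∸ t) b≡a+t)
  (≡mod-trans (≡⇒≡mod (trans (+-assoc a t (n ∸ t)) (cong (a +_) (m+[n∸m]≡n t≤n))))
  (≡mod-+-modulus a n)))

offset-exists : ∀ {n} (u v : Fin n) → ∃ λ t → t < n × toℕ v ≡ toℕ u + t [mod n ]
offset-exists {suc n} u v = t , m%n<n (toℕ v + (suc n ∸ toℕ u)) (suc n) , ≡mod-sym
  (≡mod-trans (≡mod-+ˡ (toℕ u) (%≡mod (toℕ v + (suc n ∸ toℕ u)) (suc n)))
  (≡mod-trans (≡⇒≡mod u+[v+[N-u]]≡v+N) (≡mod-+-modulus (toℕ v) (suc n))))
  where
  t : ℕ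
  t = (toℕ v + (suc n ∸ toℕ u)) % suc n
  u+[v+[N-u]]≡v+N : toℕ u + (toℕ v + (suc n ∸ toℕ u)) ≡ toℕ v + suc n
  u+[v+[N-u]]≡v+N = trans (x∙yz≈y∙xz (toℕ u) (toℕ v) _) (cong (toℕ v +_) (m+[n∸m]≡n (<⇒≤ (toℕ<n u))))

dist-offset : ∀ {n t} {u v : Fin n} → 2 ≤ n → t < n → toℕ v ≡ toℕ u + t [mod n ] →
  Dist n u v ⌈ t ⊓ (n ∸ t) /2⌉
dist-offset {n} {t} {u} {v} 2≤n t<n v≡u+t = walk , shortest
  where
  walk : Walk n u v ⌈ t ⊓ (n ∸ t) /2⌉
  walk with t ≤? n ∸ t
  ... | yes t≤n-t rewrite m≤n⇒m⊓n≡m t≤n-t = walk-forward 2≤n t v≡u+t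
  ... | no t≰n-t rewrite m≥n⇒m⊓n≡n (<⇒≤ (≰⇒> t≰n-t)) =
    walk-reverse (walk-forward 2≤n (n ∸ t) (offset-reverse (<⇒≤ t<n) v≡u+t))
  shortest : ∀ m → m < ⌈ t ⊓ (n ∸ t) /2⌉ → ¬ Walk n u v m
  shortest m m<d u⇝v = <⇒≱ m<d (m≤n+n⇒⌈m/2⌉≤n (near⇒offset≤ t<n v≡u+t (walk⇒near u⇝v)))

dist-unique : ∀ {n k k′} {u v : Fin n} → Dist n u v k → Dist n u v k′ → k ≡ k′
dist-unique {k = k} {k′} (u⇝v , k-min) (u⇝′v , k′-min) with <-cmp k k′
... | tri< k<k′ _ _ = ⊥-elim (k′-min k k<k′ u⇝v)
... | tri≈ _ k≡k′ _ = k≡k′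
... | tri> _ _ k′<k = ⊥-elim (k-min k′ k′<k u⇝′v)

dist-sym : ∀ {n k} {u v : Fin n} → Dist n u v k → Dist n v u k
dist-sym (u⇝v , k-min) = walk-reverse u⇝v , λ m m<k v⇝u → k-min m m<k (walk-reverse v⇝u)

-- D = ⌈(n − 1)/4⌉, the diameter of C(n;1,2).
record DiamBounds (n D : ℕ) : Set where
  field
    4≤n    : 4 ≤ n
    4D≤n+2 : 4 * D ≤ n + 2
    n≤4D+1 : n ≤ 4 * D + 1
open DiamBounds

diamBounds : ∀ {n} → 4 ≤ n → DiamBounds n ((n + 2) / 4)
diamBounds {n} 4≤n = record
  { 4≤n    = 4≤n
  ; 4D≤n+2 = ≤-trans (≤-reflexive (*-comm 4 D)) (≤-trans (m≤n+m (D * 4) r) (≤-reflexive (sym n+2≡r+4D)))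
  ; n≤4D+1 = +-cancelʳ-≤ 2 n (4 * D + 1) (begin
      n + 2      ≡⟨ n+2≡r+4D ⟩
      r + D * 4  ≤⟨ +-monoˡ-≤ (D * 4) (s≤s⁻¹ (m%n<n (n + 2) 4)) ⟩
      3 + D * 4  ≡⟨ trans (+-comm 3 (D * 4)) (trans (cong (_+ 3) (*-comm D 4)) (sym (+-assoc (4 * D) 1 2))) ⟩
      4 * D + 1 + 2 ∎)
  }
  where
  open ≤-Reasoning
  D r : ℕ
  D = (n + 2) / 4
  r = (n + 2) % 4
  n+2≡r+4D : n + 2 ≡ r + D * 4
  n+2≡r+4D = m≡m%n+[m/n]*n (n + 2) 4

2≤n : ∀ {n D} → DiamBounds n D → 2 ≤ n
2≤n bounds = ≤-trans (s≤s (s≤s z≤n)) (4≤n bounds)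

dist≤diam : ∀ {n D k} {u v : Fin n} → DiamBounds n D → Dist n u v k → k ≤ D
dist≤diam {n} {D} {u = u} {v} bounds u-v with offset-exists u v
... | t , t<n , v≡u+t =
  ≤-trans (≤-reflexive (dist-unique u-v (dist-offset (2≤n bounds) t<n v≡u+t)))
          (m≤n+n⇒⌈m/2⌉≤n (m+m≤n+n+1⇒m≤n (≤-trans min+min≤n
            (≤-trans (n≤4D+1 bounds) (≤-reflexive (solve (D ∷ [])))))))
  where
  min+min≤n : t ⊓ (n ∸ t) + t ⊓ (n ∸ t) ≤ n
  min+min≤n = ≤-trans (+-mono-≤ (m⊓n≤m t (n ∸ t)) (m⊓n≤n t (n ∸ t))) (≤-reflexive (m+[n∸m]≡n (<⇒≤ t<n)))

antipode : ∀ {n D} → DiamBounds n D → (u : Fin n) → ∃ λ v → Dist n u v D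
antipode {D = zero} bounds u = ⊥-elim (<⇒≱ (2≤n bounds) (n≤4D+1 bounds))
antipode {n} {suc d} bounds u =
  v , subst (Dist n u v) ⌈t⊓[n-t]/2⌉≡D (dist-offset (2≤n bounds) t<n (≡mod-sym (shift⇒≡mod u v u→v)))
  where
  t : ℕ
  t = suc (d + d)
  t+t≤n : t + t ≤ n
  t+t≤n = +-cancelʳ-≤ 2 (t + t) n (≤-trans (≤-reflexive t+t+2≡4D) (4D≤n+2 bounds))
    where
    t+t+2≡4D : suc (d + d) + suc (d + d) + 2 ≡ 4 * suc d
    t+t+2≡4D = solve (d ∷ [])
  t<n : t < n
  t<n = ≤-trans (m<m+n t {t} (s≤s z≤n)) t+t≤n
  v : Fin n
  v = proj₁ (shift-exists u t (<⇒≤ t<n))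
  u→v : Shift n u v t
  u→v = proj₂ (shift-exists u t (<⇒≤ t<n))
  ⌈t⊓[n-t]/2⌉≡D : ⌈ t ⊓ (n ∸ t) /2⌉ ≡ suc d
  ⌈t⊓[n-t]/2⌉≡D = trans (cong ⌈_/2⌉ (m≤n⇒m⊓n≡m (m+n≤o⇒m≤o∸n t t+t≤n))) (⌈1+n+n/2⌉≡1+n d)

module _ {n D : ℕ} (bounds : DiamBounds n D) where

  isEcc : ∀ (u : Fin n) → IsEcc n u D
  isEcc u = antipode bounds u , λ v k u-v → dist≤diam bounds u-v

  ecc-unique : ∀ {u : Fin n} {e} → IsEcc n u e → e ≡ D
  ecc-unique {u} ((v , u-v) , ecc-max) =
    ≤-antisym (dist≤diam bounds u-v) (ecc-max _ D (proj₂ (antipode bounds u)))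

  isDiam : IsDiam n D
  isDiam = (v₀ , isEcc v₀) , λ v e v-ecc → ≤-reflexive (ecc-unique v-ecc)
    where
    v₀ : Fin n
    v₀ = fromℕ< (≤-trans (s≤s z≤n) (4≤n bounds))

  broadcast⇒≤diam : ∀ {f} → IsBroadcast n f → ∀ v → f v ≤ D
  broadcast⇒≤diam broadcast v = broadcast v D (isEcc v)

  ≤diam⇒broadcast : ∀ {f} → (∀ v → f v ≤ D) → IsBroadcast n f
  ≤diam⇒broadcast f≤D v e v-ecc = ≤-trans (f≤D v) (≤-reflexive (sym (ecc-unique v-ecc)))

-- Independent broadcasts as separated functions on ℕ

extend : ∀ {n} → (Fin n → ℕ) → ℕ → ℕ
extend {zero}  f i       = 0
extend {suc n} f zero    = f Fin.zero
extend {suc n} f (suc i) = extend (f ∘ Fin.suc) i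

extend-toℕ : ∀ {n} (f : Fin n → ℕ) u → extend f (toℕ u) ≡ f u
extend-toℕ {suc n} f Fin.zero    = refl
extend-toℕ {suc n} f (Fin.suc u) = extend-toℕ (f ∘ Fin.suc) u

extend-fromℕ< : ∀ {n i} (f : Fin n → ℕ) (i<n : i < n) → extend f i ≡ f (fromℕ< i<n)
extend-fromℕ< f i<n = trans (cong (extend f) (sym (toℕ-fromℕ< i<n))) (extend-toℕ f (fromℕ< i<n))

sumBelow : (ℕ → ℕ) → ℕ → ℕ
sumBelow g zero    = 0
sumBelow g (suc m) = sumBelow g m + g m

sumBelow-suc : ∀ g m → sumBelow g (suc m) ≡ g 0 + sumBelow (g ∘ suc) m
sumBelow-suc g zero    = +-comm 0 (g 0)
sumBelow-suc g (suc m) = trans (cong (_+ g (suc m)) (sumBelow-suc g m)) (+-assoc (g 0) _ _)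

sumBelow-cong : ∀ {g h} m → (∀ {i} → i < m → g i ≡ h i) → sumBelow g m ≡ sumBelow h m
sumBelow-cong zero    g≗h = refl
sumBelow-cong (suc m) g≗h = cong₂ _+_ (sumBelow-cong m (g≗h ∘ m<n⇒m<1+n)) (g≗h ≤-refl)

sum-tabulate : ∀ n (f : Fin n → ℕ) → sum (tabulate f) ≡ sumBelow (extend f) n
sum-tabulate zero    f = refl
sum-tabulate (suc n) f =
  trans (cong (f Fin.zero +_) (sum-tabulate n (f ∘ Fin.suc))) (sym (sumBelow-suc (extend f) n))

cost≡sumBelow : ∀ n (f : Fin n → ℕ) → cost n f ≡ sumBelow (extend f) n
cost≡sumBelow n f = trans (cong sum (map-tabulate id f)) (sum-tabulate n f)

cost-toℕ : ∀ n (g : ℕ → ℕ) → cost n (g ∘ toℕ) ≡ sumBelow g n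
cost-toℕ n g = trans (cost≡sumBelow n (g ∘ toℕ))
  (sumBelow-cong n λ i<n → trans (extend-fromℕ< (g ∘ toℕ) i<n) (cong g (toℕ-fromℕ< i<n)))

Separated : ℕ → (ℕ → ℕ) → Set
Separated n g = ∀ {i j} → i < j → j < n → 0 < g i → 0 < g j →
  let M = g i ⊔ g j in M + M < (j ∸ i) ⊓ (n ∸ (j ∸ i))

offset-< : ∀ {n} {u v : Fin n} → toℕ u < toℕ v → toℕ v ≡ toℕ u + (toℕ v ∸ toℕ u) [mod n ]
offset-< u<v = ≡⇒≡mod (sym (m+[n∸m]≡n (<⇒≤ u<v)))

separated⇒<dist : ∀ {n k} (g : ℕ → ℕ) {a b : Fin n} → 2 ≤ n → Separated n g →
  toℕ a < toℕ b → Dist n a b k → 0 < g (toℕ a) → 0 < g (toℕ b) → g (toℕ a) ⊔ g (toℕ b) < k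
separated⇒<dist {n} g {a} {b} 2≤n separated a<b a-b a>0 b>0 =
  subst (_ <_) (sym (dist-unique a-b (dist-offset 2≤n t<n (offset-< a<b))))
    (n+n<m⇒n<⌈m/2⌉ (separated a<b (toℕ<n b) a>0 b>0))
  where
  t<n : toℕ b ∸ toℕ a < n
  t<n = ≤-<-trans (m∸n≤m (toℕ b) (toℕ a)) (toℕ<n b)

separated⇒independent : ∀ {n} (g : ℕ → ℕ) → 2 ≤ n → Separated n g → IsIndependent n (g ∘ toℕ)
separated⇒independent g 2≤n separated u v u≢v u>0 v>0 k u-v with <-cmp (toℕ u) (toℕ v)
... | tri< u<v _ _ = separated⇒<dist g 2≤n separated u<v u-v u>0 v>0
... | tri≈ _ u≡v _ = ⊥-elim (u≢v (toℕ-injective u≡v))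
... | tri> _ _ v<u = subst (_< k) (⊔-comm (g (toℕ v)) (g (toℕ u)))
  (separated⇒<dist g 2≤n separated v<u (dist-sym u-v) v>0 u>0)

independent⇒separated : ∀ {n} (f : Fin n → ℕ) → 2 ≤ n → IsIndependent n f → Separated n (extend f)
independent⇒separated {n} f 2≤n independent {i} {j} i<j j<n i>0 j>0 =
  n<⌈m/2⌉⇒n+n<m (subst₂ (λ x y → x ⊔ y < _) (sym fi) (sym fj)
    (independent u v u≢v (subst (0 <_) fi i>0) (subst (0 <_) fj j>0) _
      (dist-offset 2≤n t<n (subst₂ (λ x y → y ≡ x + t [mod n ]) (sym (toℕ-fromℕ< i<n)) (sym (toℕ-fromℕ< j<n))
        (≡⇒≡mod (sym (m+[n∸m]≡n (<⇒≤ i<j))))))))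
  where
  t : ℕ
  t = j ∸ i
  i<n : i < n
  i<n = <-trans i<j j<n
  t<n : t < n
  t<n = ≤-<-trans (m∸n≤m j i) j<n
  u v : Fin n
  u = fromℕ< i<n
  v = fromℕ< j<n
  fi : extend f i ≡ f u
  fi = extend-fromℕ< f i<n
  fj : extend f j ≡ f v
  fj = extend-fromℕ< f j<n
  u≢v : u ≢ v
  u≢v u≡v = <⇒≢ i<j (trans (sym (toℕ-fromℕ< i<n)) (trans (cong toℕ u≡v) (toℕ-fromℕ< j<n)))

separated-gaps : ∀ {n g i j} → Separated n g → i < j → j < n → 0 < g i → 0 < g j →
  let M = g i ⊔ g j in M + M + i < j × M + M + j < n + i
separated-gaps {n} {g} {i} {j} separated i<j j<n i>0 j>0 =
  m≤o∸n⇒m+n≤o (suc (M + M)) i≤j (≤-trans 2M<min (m⊓n≤m t (n ∸ t))) ,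
  (begin-strict
    M + M + j        ≡⟨ cong (M + M +_) (sym (m∸n+n≡m i≤j)) ⟩
    M + M + (t + i)  ≡⟨ sym (+-assoc (M + M) t i) ⟩
    M + M + t + i    <⟨ +-monoˡ-< i (m≤o∸n⇒m+n≤o (suc (M + M)) t≤n (≤-trans 2M<min (m⊓n≤n t (n ∸ t)))) ⟩
    n + i            ∎)
  where
  open ≤-Reasoning
  M t : ℕ
  M = g i ⊔ g j
  t = j ∸ i
  i≤j : i ≤ j
  i≤j = <⇒≤ i<j
  t≤n : t ≤ n
  t≤n = ≤-trans (m∸n≤m j i) (<⇒≤ j<n)
  2M<min : M + M < t ⊓ (n ∸ t)
  2M<min = separated i<j j<n i>0 j>0

-- The packing bound

support : (ℕ → ℕ) → ℕ → ℕ
support g zero    = 0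
support g (suc m) = support g m + (1 ⊓ g m)

1⊓n≡1 : ∀ {n} → 0 < n → 1 ⊓ n ≡ 1
1⊓n≡1 {suc n} _ = refl

sumBelow-zero : ∀ {g} m → (∀ {i} → i < m → g i ≡ 0) → sumBelow g m ≡ 0
sumBelow-zero zero    g≡0 = refl
sumBelow-zero (suc m) g≡0 = cong₂ _+_ (sumBelow-zero m (g≡0 ∘ m<n⇒m<1+n)) (g≡0 ≤-refl)

support-zero : ∀ {g} m → (∀ {i} → i < m → g i ≡ 0) → support g m ≡ 0
support-zero zero    g≡0 = refl
support-zero (suc m) g≡0 = cong₂ _+_ (support-zero m (g≡0 ∘ m<n⇒m<1+n)) (cong (1 ⊓_) (g≡0 ≤-refl))

sumBelow-const : ∀ {g a} m → (∀ {i} → i < m → 0 < g i → g i ≡ a) → sumBelow g m ≡ support g m * a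
sumBelow-const zero const = refl
sumBelow-const {g} {a} (suc m) const with g m in gm≡
... | zero  = trans (+-identityʳ _) (trans (sumBelow-const m (const ∘ m<n⇒m<1+n)) (cong (_* a) (sym (+-identityʳ (support g m)))))
... | suc x = begin
  sumBelow g m + suc x    ≡⟨ cong₂ _+_ (sumBelow-const m (const ∘ m<n⇒m<1+n)) 1+x≡a ⟩
  support g m * a + a     ≡⟨ k*a+a≡[k+1]*a (support g m) a ⟩
  (support g m + 1) * a   ∎
  where
  open ≡-Reasoning
  1+x≡a : suc x ≡ a
  1+x≡a = trans (sym gm≡) (const ≤-refl (subst (0 <_) (sym gm≡) z<s))
  k*a+a≡[k+1]*a : ∀ k a → k * a + a ≡ (k + 1) * a
  k*a+a≡[k+1]*a = solve-∀

-- Consecutive positive positions i < j of a separated g satisfy 2 (g i ⊔ g j) + i < j; summed over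
-- the positive positions in [0, m), this telescopes to `packed`, where `excess` bounds the total
-- rise of g along them.
record Scanned (g : ℕ → ℕ) (m : ℕ) : Set where
  field
    first last excess : ℕ
    last<m     : last < m
    first>0    : 0 < g first
    last>0     : 0 < g last
    support≥1  : 1 ≤ support g m
    one⊎many   : last ≡ first ⊎ (first < last × 2 ≤ support g m)
    packed     : sumBelow g m + sumBelow g m + support g m + (excess + excess) + first
                   ≤ last + (g last + g last) + 1
    ≤first     : ∀ {i} → i < m → 0 < g i → g i ≤ g first + excess
    last≤      : ∀ {i} → i < m → 0 < g i → g last ≤ g i + excess

ScanState : (ℕ → ℕ) → ℕ → Set
ScanState g m = (∀ {i} → i < m → g i ≡ 0) ⊎ Scanned g m

scan-skip : ∀ {g m} → g m ≡ 0 → ScanState g m → ScanState g (suc m)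
scan-skip {g} {m} gm≡0 (inj₁ g≡0) = inj₁ λ i<1+m → [ g≡0 , (λ i≡m → trans (cong g i≡m) gm≡0) ]′ (m<1+n⇒m<n∨m≡n i<1+m)
scan-skip {g} {m} gm≡0 (inj₂ s) = inj₂ record
  { first = first ; last = last ; excess = excess
  ; last<m    = m<n⇒m<1+n last<m
  ; first>0   = first>0
  ; last>0    = last>0
  ; support≥1 = subst (1 ≤_) (sym K≡) support≥1
  ; one⊎many  = Sum.map₂ (Product.map₂ (subst (2 ≤_) (sym K≡))) one⊎many
  ; packed    = subst (_≤ last + (g last + g last) + 1) (cong₂ (λ σ k → σ + σ + k + (excess + excess) + first) (sym S≡) (sym K≡)) packed
  ; ≤first    = below-suc ≤first
  ; last≤     = below-suc last≤
  }
  where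
  open Scanned s
  S≡ : sumBelow g (suc m) ≡ sumBelow g m
  S≡ = trans (cong (sumBelow g m +_) gm≡0) (+-identityʳ _)
  K≡ : support g (suc m) ≡ support g m
  K≡ = trans (cong (λ x → support g m + 1 ⊓ x) gm≡0) (+-identityʳ _)
  below-suc : ∀ {P : ℕ → Set} → (∀ {i} → i < m → 0 < g i → P i) → ∀ {i} → i < suc m → 0 < g i → P i
  below-suc P< i<1+m gi>0 with m<1+n⇒m<n∨m≡n i<1+m
  ... | inj₁ i<m = P< i<m gi>0
  ... | inj₂ refl = ⊥-elim (<⇒≢ gi>0 (sym gm≡0))

scan-start : ∀ {g m} → 0 < g m → (∀ {i} → i < m → g i ≡ 0) → Scanned g (suc m)
scan-start {g} {m} gm>0 g≡0 = record
  { first = m ; last = m ; excess = 0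
  ; last<m    = ≤-refl
  ; first>0   = gm>0
  ; last>0    = gm>0
  ; support≥1 = ≤-reflexive (sym K≡1)
  ; one⊎many  = inj₁ refl
  ; packed    = ≤-reflexive (begin
      sumBelow g (suc m) + sumBelow g (suc m) + support g (suc m) + 0 + m
        ≡⟨ cong₂ (λ σ k → σ + σ + k + 0 + m) S≡gm K≡1 ⟩
      g m + g m + 1 + 0 + m
        ≡⟨ regroup (g m) m ⟩
      m + (g m + g m) + 1 ∎)
  ; ≤first    = λ i<1+m gi>0 → ≤-reflexive (trans (cong g (only i<1+m gi>0)) (sym (+-identityʳ _)))
  ; last≤     = λ i<1+m gi>0 → ≤-reflexive (trans (cong g (sym (only i<1+m gi>0))) (sym (+-identityʳ _)))
  }
  where
  open ≡-Reasoning
  S≡gm : sumBelow g (suc m) ≡ g m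
  S≡gm = cong (_+ g m) (sumBelow-zero m g≡0)
  K≡1 : support g (suc m) ≡ 1
  K≡1 = cong₂ _+_ (support-zero m g≡0) (1⊓n≡1 gm>0)
  only : ∀ {i} → i < suc m → 0 < g i → i ≡ m
  only i<1+m gi>0 with m<1+n⇒m<n∨m≡n i<1+m
  ... | inj₁ i<m = ⊥-elim (<⇒≢ gi>0 (sym (g≡0 i<m)))
  ... | inj₂ i≡m = i≡m
  regroup : ∀ a m → a + a + 1 + 0 + m ≡ m + (a + a) + 1
  regroup = solve-∀

packed-step : ∀ {σ k e f l b m a r} → σ + σ + k + (e + e) + f ≤ l + (b + b) + 1 →
  (b + r) + (b + r) + l < m → (σ + a) + (σ + a) + (k + 1) + ((e + r) + (e + r)) + f ≤ m + (a + a) + 1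
packed-step {σ} {k} {e} {f} {l} {b} {m} {a} {r} packed gap = begin
  (σ + a) + (σ + a) + (k + 1) + ((e + r) + (e + r)) + f  ≡⟨ solve (σ ∷ k ∷ e ∷ f ∷ a ∷ r ∷ []) ⟩
  (σ + σ + k + (e + e) + f) + (a + a) + 1 + (r + r)      ≤⟨ +-monoˡ-≤ (r + r) (+-monoˡ-≤ 1 (+-monoˡ-≤ (a + a) packed)) ⟩
  l + (b + b) + 1 + (a + a) + 1 + (r + r)                ≡⟨ solve (l ∷ b ∷ a ∷ r ∷ []) ⟩
  suc ((b + r) + (b + r) + l) + (a + a) + 1              ≤⟨ +-monoˡ-≤ 1 (+-monoˡ-≤ (a + a) gap) ⟩
  m + (a + a) + 1                                        ∎
  where open ≤-Reasoning

packed-close : ∀ {σ k e f l b n r} → σ + σ + k + (e + e) + f ≤ l + (b + b) + 1 →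
  (b + r) + (b + r) + l < n + f → σ + σ + k + ((e + r) + (e + r)) ≤ n
packed-close {σ} {k} {e} {f} {l} {b} {n} {r} packed gap = +-cancelʳ-≤ f _ _ (begin
  σ + σ + k + ((e + r) + (e + r)) + f   ≡⟨ solve (σ ∷ k ∷ e ∷ r ∷ f ∷ []) ⟩
  (σ + σ + k + (e + e) + f) + (r + r)   ≤⟨ +-monoˡ-≤ (r + r) packed ⟩
  l + (b + b) + 1 + (r + r)             ≡⟨ solve (l ∷ b ∷ r ∷ []) ⟩
  suc ((b + r) + (b + r) + l)           ≤⟨ gap ⟩
  n + f                                 ∎)
  where open ≤-Reasoning

scan-extend : ∀ {n g m} → Separated n g → m < n → 0 < g m → Scanned g m → Scanned g (suc m)
scan-extend {n} {g} {m} separated m<n gm>0 s = record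
  { first = first ; last = m ; excess = excess + rise
  ; last<m    = ≤-refl
  ; first>0   = first>0
  ; last>0    = gm>0
  ; support≥1 = ≤-trans support≥1 (≤-trans (m≤m+n _ 1) (≤-reflexive (sym K≡K+1)))
  ; one⊎many  = inj₂ (≤-<-trans first≤last last<m , ≤-trans (+-monoˡ-≤ 1 support≥1) (≤-reflexive (sym K≡K+1)))
  ; packed    = packed′
  ; ≤first    = ≤first′
  ; last≤     = last≤′
  }
  where
  open Scanned s
  rise : ℕ
  rise = g m ∸ g last
  first≤last : first ≤ last
  first≤last = [ ≤-reflexive ∘ sym , <⇒≤ ∘ proj₁ ]′ one⊎many
  K≡K+1 : support g (suc m) ≡ support g m + 1
  K≡K+1 = cong (support g m +_) (1⊓n≡1 gm>0)
  gm≤ : g m ≤ g last + rise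
  gm≤ = ≤-trans (m≤n⊔m (g last) (g m)) (≤-reflexive (m⊔n≡m+[n∸m] (g last) (g m)))
  gap : (g last + rise) + (g last + rise) + last < m
  gap = subst (λ M → M + M + last < m) (m⊔n≡m+[n∸m] (g last) (g m))
          (proj₁ (separated-gaps separated last<m m<n last>0 gm>0))
  packed′ : sumBelow g (suc m) + sumBelow g (suc m) + support g (suc m) + ((excess + rise) + (excess + rise)) + first
              ≤ m + (g m + g m) + 1
  packed′ = subst (λ K → sumBelow g (suc m) + sumBelow g (suc m) + K + ((excess + rise) + (excess + rise)) + first
                           ≤ m + (g m + g m) + 1)
                  (sym K≡K+1) (packed-step {sumBelow g m} {support g m} {excess} {first} {last} {g last} {m} {g m} {rise} packed gap)
  ≤first′ : ∀ {i} → i < suc m → 0 < g i → g i ≤ g first + (excess + rise)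
  ≤first′ i<1+m gi>0 with m<1+n⇒m<n∨m≡n i<1+m
  ... | inj₁ i<m = ≤-trans (≤first i<m gi>0) (+-monoʳ-≤ (g first) (m≤m+n excess rise))
  ... | inj₂ refl = ≤-trans gm≤ (≤-trans (+-monoˡ-≤ rise (≤first last<m last>0)) (≤-reflexive (+-assoc (g first) excess rise)))
  last≤′ : ∀ {i} → i < suc m → 0 < g i → g m ≤ g i + (excess + rise)
  last≤′ i<1+m gi>0 with m<1+n⇒m<n∨m≡n i<1+m
  ... | inj₁ i<m = ≤-trans gm≤ (≤-trans (+-monoˡ-≤ rise (last≤ i<m gi>0)) (≤-reflexive (+-assoc (g _) excess rise)))
  ... | inj₂ refl = m≤m+n (g m) (excess + rise)

scan : ∀ {n g} → Separated n g → ∀ m → m ≤ n → ScanState g m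
scan separated zero    _     = inj₁ λ ()
scan {g = g} separated (suc m) 1+m≤n with g m in gm≡ | scan separated m (≤-trans (n≤1+n m) 1+m≤n)
... | zero  | state        = scan-skip gm≡ state
... | suc _ | inj₁ g≡0     = inj₂ (scan-start (subst (0 <_) (sym gm≡) z<s) g≡0)
... | suc _ | inj₂ scanned = inj₂ (scan-extend separated 1+m≤n (subst (0 <_) (sym gm≡) z<s) scanned)

record Packing (n σ : ℕ) : Set where
  field
    k e      : ℕ
    2≤k      : 2 ≤ k
    packed   : σ + σ + k + (e + e) ≤ n
    balanced : e ≡ 0 → ∃ λ a → σ ≡ k * a

scanned⇒packing : ∀ {n g D} → Separated n g → (∀ {i} → i < n → g i ≤ D) → Scanned g n →
  sumBelow g n ≤ D ⊎ Packing n (sumBelow g n)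
scanned⇒packing {n} {g} {D} separated g≤D s with Scanned.one⊎many s
... | inj₁ refl = inj₁ (≤-trans (m+m≤n+n+1⇒m≤n S+S≤2gl+1) (g≤D last<m))
  where
  open Scanned s
  S+S≤2gl+1 : sumBelow g n + sumBelow g n ≤ g last + g last + 1
  S+S≤2gl+1 = +-cancelʳ-≤ last _ _ (begin
    sumBelow g n + sumBelow g n + last
      ≤⟨ +-monoˡ-≤ last (≤-trans (m≤m+n _ (support g n)) (m≤m+n _ (excess + excess))) ⟩
    sumBelow g n + sumBelow g n + support g n + (excess + excess) + last
      ≤⟨ packed ⟩
    last + (g last + g last) + 1
      ≡⟨ regroup last (g last) ⟩
    g last + g last + 1 + last ∎)
    where
    open ≤-Reasoning
    regroup : ∀ l b → l + (b + b) + 1 ≡ b + b + 1 + l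
    regroup = solve-∀
... | inj₂ (first<last , 2≤K) = inj₂ record
  { k = support g n ; e = excess + fall ; 2≤k = 2≤K ; packed = packed′ ; balanced = balanced }
  where
  open Scanned s
  fall : ℕ
  fall = g first ∸ g last
  gap : (g last + fall) + (g last + fall) + last < n + first
  gap = subst (λ M → M + M + last < n + first) (trans (⊔-comm (g first) (g last)) (m⊔n≡m+[n∸m] (g last) (g first)))
          (proj₂ (separated-gaps separated first<last last<m first>0 last>0))
  packed′ : sumBelow g n + sumBelow g n + support g n + ((excess + fall) + (excess + fall)) ≤ n
  packed′ = packed-close {sumBelow g n} {support g n} {excess} {first} {last} {g last} {n} {fall} packed gap
  -- with excess = fall = 0, ≤first and last≤ pin every positive value to g first
  balanced : excess + fall ≡ 0 → ∃ λ a → sumBelow g n ≡ support g n * a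
  balanced excess+fall≡0 = g first , sumBelow-const n λ i<n gi>0 → ≤-antisym
    (≤-trans (≤first i<n gi>0) (≤-reflexive (trans (cong (g first +_) excess≡0) (+-identityʳ _))))
    (≤-trans (m∸n≡0⇒m≤n fall≡0) (≤-trans (last≤ i<n gi>0) (≤-reflexive (trans (cong (_ +_) excess≡0) (+-identityʳ _)))))
    where
    excess≡0 : excess ≡ 0
    excess≡0 = m+n≡0⇒m≡0 excess excess+fall≡0
    fall≡0 : fall ≡ 0
    fall≡0 = m+n≡0⇒n≡0 excess excess+fall≡0

separated⇒packing : ∀ {n g D} → Separated n g → (∀ {i} → i < n → g i ≤ D) →
  sumBelow g n ≤ D ⊎ Packing n (sumBelow g n)
separated⇒packing {n} separated g≤D with scan separated n ≤-refl
... | inj₁ g≡0    = inj₁ (≤-trans (≤-reflexive (sumBelow-zero n g≡0)) z≤n)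
... | inj₂ scanned = scanned⇒packing separated g≤D scanned

broadcast-packing : ∀ {n D} {f : Fin n → ℕ} → DiamBounds n D → IsBroadcast n f → IsIndependent n f →
  cost n f ≤ D ⊎ Packing n (cost n f)
broadcast-packing {n} {D} {f} bounds broadcast independent rewrite cost≡sumBelow n f =
  separated⇒packing (independent⇒separated f (2≤n bounds) independent)
    λ i<n → subst (_≤ D) (sym (extend-fromℕ< f i<n)) (broadcast⇒≤diam bounds broadcast _)

packing-coarse : ∀ {n σ B} → Packing n σ → n ≤ B + B + 3 → σ ≤ B
packing-coarse {n} {σ} {B} p n≤2B+3 = m+m≤n+n+1⇒m≤n (+-cancelʳ-≤ 2 _ _ (begin
  σ + σ + 2              ≤⟨ +-monoʳ-≤ (σ + σ) 2≤k ⟩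
  σ + σ + k              ≤⟨ m≤m+n (σ + σ + k) (e + e) ⟩
  σ + σ + k + (e + e)    ≤⟨ packed ⟩
  n                      ≤⟨ n≤2B+3 ⟩
  B + B + 3              ≡⟨ sym (+-assoc (B + B) 1 2) ⟩
  B + B + 1 + 2          ∎))
  where
  open Packing p
  open ≤-Reasoning

packing-tight : ∀ {n σ c} → Packing n σ → c ≤ σ → n ≤ c + c + 3 →
  ∃ λ a → c ≡ 2 * a ⊎ (c ≡ 3 * a × n ≡ c + c + 3)
packing-tight {n} {σ} {c} p c≤σ n≤2c+3 =
  a , [ inj₁ ∘ c≡ka , (λ k≡3 → inj₂ (c≡ka k≡3 , n≡2c+3 k≡3)) ]′ (m≤n≤1+m 2≤k k≤3)
  where
  open Packing p
  open ≤-Reasoning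
  c≡σ : c ≡ σ
  c≡σ = ≤-antisym c≤σ (packing-coarse p n≤2c+3)
  k+2e≤3 : k + (e + e) ≤ 3
  k+2e≤3 = +-cancelˡ-≤ (c + c) _ _ (begin
    c + c + (k + (e + e))  ≡⟨ sym (+-assoc (c + c) k (e + e)) ⟩
    c + c + k + (e + e)    ≡⟨ cong (λ x → x + x + k + (e + e)) c≡σ ⟩
    σ + σ + k + (e + e)    ≤⟨ packed ⟩
    n                      ≤⟨ n≤2c+3 ⟩
    c + c + 3              ∎)
  k≤3 : k ≤ 3
  k≤3 = ≤-trans (m≤m+n k (e + e)) k+2e≤3
  e≡0 : e ≡ 0
  e≡0 = n≤0⇒n≡0 (m+m≤n+n+1⇒m≤n (+-cancelˡ-≤ 2 _ _ (≤-trans (+-monoˡ-≤ (e + e) 2≤k) k+2e≤3)))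
  a : ℕ
  a = proj₁ (balanced e≡0)
  c≡ka : ∀ {j} → k ≡ j → c ≡ j * a
  c≡ka k≡j = trans c≡σ (trans (proj₂ (balanced e≡0)) (cong (_* a) k≡j))
  n≡2c+3 : k ≡ 3 → n ≡ c + c + 3
  n≡2c+3 k≡3 = ≤-antisym n≤2c+3 (begin
    c + c + 3              ≡⟨ cong₂ (λ x y → x + x + y) c≡σ (sym k≡3) ⟩
    σ + σ + k              ≤⟨ m≤m+n (σ + σ + k) (e + e) ⟩
    σ + σ + k + (e + e)    ≤⟨ packed ⟩
    n                      ∎)

odd-3a⇒[6a+3]%12≡9 : ∀ {p a} → suc (p + p) ≡ 3 * a → (3 * a + 3 * a + 3) % 12 ≡ 9
odd-3a⇒[6a+3]%12≡9 {p} {a} 1+2p≡3a with a % 2 in a%2≡r | m%n<n a 2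
... | 0 | _ = ⊥-elim (odd≢even p (3 * (a / 2)) (trans 1+2p≡3a (begin
  3 * a                        ≡⟨ cong (3 *_) (trans (m≡m%n+[m/n]*n a 2) (cong (_+ a / 2 * 2) a%2≡r)) ⟩
  3 * (0 + a / 2 * 2)          ≡⟨ 3*[2s]≡3s+3s (a / 2) ⟩
  3 * (a / 2) + 3 * (a / 2)    ∎)))
  where
  open ≡-Reasoning
  3*[2s]≡3s+3s : ∀ s → 3 * (0 + s * 2) ≡ 3 * s + 3 * s
  3*[2s]≡3s+3s = solve-∀
... | 1 | _ = begin
  (3 * a + 3 * a + 3) % 12                   ≡⟨ cong (λ x → (3 * x + 3 * x + 3) % 12) a≡1+2s ⟩
  (3 * (1 + s * 2) + 3 * (1 + s * 2) + 3) % 12 ≡⟨ cong (_% 12) (6[1+2s]+3≡9+12s s) ⟩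
  (9 + s * 12) % 12                          ≡⟨ [m+kn]%n≡m%n 9 s 12 ⟩
  9                                          ∎
  where
  open ≡-Reasoning
  s : ℕ
  s = a / 2
  a≡1+2s : a ≡ 1 + s * 2
  a≡1+2s = trans (m≡m%n+[m/n]*n a 2) (cong (_+ s * 2) a%2≡r)
  6[1+2s]+3≡9+12s : ∀ s → 3 * (1 + s * 2) + 3 * (1 + s * 2) + 3 ≡ 9 + s * 12
  6[1+2s]+3≡9+12s = solve-∀
... | suc (suc _) | s≤s (s≤s ())

packing-fine : ∀ {n σ d} → Packing n σ → n ≤ 4 * suc (suc d) + 1 → n % 12 ≢ 9 → σ ≤ 2 * suc d
packing-fine {n} {σ} {d} p n≤4D+1 n%12≢9 with σ ≤? 2 * suc d
... | yes σ≤2D-2 = σ≤2D-2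
... | no σ≰2D-2 with packing-tight p (subst (λ x → suc x ≤ σ) (cong (suc d +_) (+-identityʳ (suc d))) (≰⇒> σ≰2D-2))
                                    (≤-trans n≤4D+1 (≤-reflexive (4D+1≡2c+3 d)))
  where
  4D+1≡2c+3 : ∀ d → 4 * suc (suc d) + 1 ≡ suc (suc d + suc d) + suc (suc d + suc d) + 3
  4D+1≡2c+3 = solve-∀
...   | a , inj₁ c≡2a = ⊥-elim (odd≢even (suc d) a (trans c≡2a (cong (a +_) (+-identityʳ a))))
...   | a , inj₂ (c≡3a , n≡2c+3) = ⊥-elim (n%12≢9 (begin
  n % 12                                       ≡⟨ cong (_% 12) n≡2c+3 ⟩
  (suc (suc d + suc d) + suc (suc d + suc d) + 3) % 12  ≡⟨ cong (λ x → (x + x + 3) % 12) c≡3a ⟩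
  (3 * a + 3 * a + 3) % 12                     ≡⟨ odd-3a⇒[6a+3]%12≡9 {suc d} {a} c≡3a ⟩
  9                                            ∎))
  where open ≡-Reasoning

-- Equally spaced broadcasts

marks : ℕ → ℕ → ℕ → ℕ → ℕ
marks h zero    c i = 0
marks h (suc k) c i with i ≟ k * h
... | yes _ = c
... | no  _ = marks h k c i

marks-≤ : ∀ h k c i → marks h k c i ≤ c
marks-≤ h zero    c i = z≤n
marks-≤ h (suc k) c i with i ≟ k * h
... | yes _ = ≤-refl
... | no  _ = marks-≤ h k c i

marks>0 : ∀ h k c i → 0 < marks h k c i → ∃ λ a → a < k × i ≡ a * h
marks>0 h (suc k) c i positive with i ≟ k * h
... | yes i≡kh = k , ≤-refl , i≡kh
... | no  _    = Product.map₂ (Product.map₁ m<n⇒m<1+n) (marks>0 h k c i positive)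

marks-new : ∀ h k c → marks h (suc k) c (k * h) ≡ c
marks-new h k c with k * h ≟ k * h
... | yes _   = refl
... | no  k≢k = ⊥-elim (k≢k refl)

marks-old : ∀ h k c {i} → i ≢ k * h → marks h (suc k) c i ≡ marks h k c i
marks-old h k c {i} i≢kh with i ≟ k * h
... | yes i≡kh = ⊥-elim (i≢kh i≡kh)
... | no  _    = refl

marks-fresh : ∀ {h} → 0 < h → ∀ k c → marks h k c (k * h) ≡ 0
marks-fresh {h} h>0 k c with marks h k c (k * h) | marks>0 h k c (k * h)
... | zero  | _         = refl
... | suc _ | positioned with positioned z<s
...   | a , a<k , kh≡ah = ⊥-elim (<⇒≢ a<k (sym (*-cancelʳ-≡ k a h {{>-nonZero h>0}} kh≡ah)))

sumBelow-bump : ∀ {g g′ p c} m → p < m → g′ p ≡ g p + c → (∀ {i} → i ≢ p → g′ i ≡ g i) →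
  sumBelow g′ m ≡ sumBelow g m + c
sumBelow-bump {g} {g′} {p} {c} (suc m) p<1+m g′p≡gp+c g′≡g with m<1+n⇒m<n∨m≡n p<1+m
... | inj₁ p<m = begin
  sumBelow g′ m + g′ m   ≡⟨ cong₂ _+_ (sumBelow-bump m p<m g′p≡gp+c g′≡g) (g′≡g (≢-sym (<⇒≢ p<m))) ⟩
  sumBelow g m + c + g m ≡⟨ xy∙z≈xz∙y (sumBelow g m) c (g m) ⟩
  sumBelow g m + g m + c ∎
  where open ≡-Reasoning
... | inj₂ refl = begin
  sumBelow g′ p + g′ p      ≡⟨ cong₂ _+_ (sumBelow-cong p (λ i<p → g′≡g (<⇒≢ i<p))) g′p≡gp+c ⟩
  sumBelow g p + (g p + c)  ≡⟨ sym (+-assoc (sumBelow g p) (g p) c) ⟩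
  sumBelow g p + g p + c    ∎
  where open ≡-Reasoning

marks-sum : ∀ {n h} → 0 < h → ∀ k c → k * h ≤ n → sumBelow (marks h k c) n ≡ k * c
marks-sum {n} h>0 zero    c _     = sumBelow-zero n (λ _ → refl)
marks-sum {n} {h} h>0 (suc k) c kh+h≤n = begin
  sumBelow (marks h (suc k) c) n  ≡⟨ sumBelow-bump n kh<n (trans (marks-new h k c) (sym (cong (_+ c) (marks-fresh h>0 k c))))
                                                          (marks-old h k c) ⟩
  sumBelow (marks h k c) n + c    ≡⟨ cong (_+ c) (marks-sum h>0 k c (≤-trans (m≤n+m (k * h) h) kh+h≤n)) ⟩
  k * c + c                       ≡⟨ +-comm (k * c) c ⟩
  suc k * c                       ∎
  where
  open ≡-Reasoning
  kh<n : k * h < n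
  kh<n = <-≤-trans (m<n+m (k * h) h>0) kh+h≤n

marks-separated : ∀ {n h k c} → c + c < h → k * h ≤ n → Separated n (marks h k c)
marks-separated {n} {h} {k} {c} 2c<h kh≤n {i} {j} i<j j<n mi>0 mj>0
  with marks>0 h k c i mi>0 | marks>0 h k c j mj>0
... | a , a<k , refl | b , b<k , refl = begin-strict
  M + M         ≤⟨ +-mono-≤ M≤c M≤c ⟩
  c + c         <⟨ 2c<h ⟩
  h             ≤⟨ ⊓-glb h≤t (m+n≤o⇒m≤o∸n h h+t≤n) ⟩
  t ⊓ (n ∸ t)   ∎
  where
  open ≤-Reasoning
  M t : ℕ
  M = marks h k c (a * h) ⊔ marks h k c (b * h)
  t = b * h ∸ a * h
  M≤c : M ≤ c
  M≤c = ⊔-lub (marks-≤ h k c (a * h)) (marks-≤ h k c (b * h))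
  a<b : a < b
  a<b = *-cancelʳ-< h a b i<j
  t≡[b-a]h : t ≡ (b ∸ a) * h
  t≡[b-a]h = sym (*-distribʳ-∸ h b a)
  h≤t : h ≤ t
  h≤t = begin
    h            ≡⟨ sym (+-identityʳ h) ⟩
    1 * h        ≤⟨ *-monoˡ-≤ h (m<n⇒0<n∸m a<b) ⟩
    (b ∸ a) * h  ≡⟨ sym t≡[b-a]h ⟩
    t            ∎
  h+t≤n : h + t ≤ n
  h+t≤n = begin
    h + t              ≡⟨ cong (h +_) t≡[b-a]h ⟩
    suc (b ∸ a) * h    ≤⟨ *-monoˡ-≤ h (≤-<-trans (m∸n≤m b a) b<k) ⟩
    k * h              ≤⟨ kh≤n ⟩
    n                  ∎

spaced-broadcast : ∀ {n D k h c} → DiamBounds n D → c + c < h → k * h ≤ n → c ≤ D →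
  ∃ λ f → IsBroadcast n f × IsIndependent n f × cost n f ≡ k * c
spaced-broadcast {n} {D} {k} {h} {c} bounds 2c<h kh≤n c≤D =
  marks h k c ∘ toℕ ,
  ≤diam⇒broadcast bounds (λ v → ≤-trans (marks-≤ h k c (toℕ v)) c≤D) ,
  separated⇒independent (marks h k c) (2≤n bounds) (marks-separated {k = k} {c} 2c<h kh≤n) ,
  trans (cost-toℕ n (marks h k c)) (marks-sum (<-≤-trans (s≤s z≤n) 2c<h) k c kh≤n)

-- The independence number for n ∈ {4, 5}

walk≤1⇒adj : ∀ {n k} {u v : Fin n} → Walk n u v k → k ≤ 1 → u ≢ v → Adj n u v
walk≤1⇒adj here                _          u≢u = ⊥-elim (u≢u refl)
walk≤1⇒adj (step u~v here)     _          _   = u~v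
walk≤1⇒adj (step _ (step _ _)) (s≤s ()) _

diam≡1⇒adj : ∀ {n} {u v : Fin n} → DiamBounds n 1 → u ≢ v → Adj n u v
diam≡1⇒adj {n} {u} {v} bounds u≢v with offset-exists u v
... | t , t<n , v≡u+t = walk≤1⇒adj (proj₁ u-v) (dist≤diam bounds u-v) u≢v
  where
  u-v : Dist n u v ⌈ t ⊓ (n ∸ t) /2⌉
  u-v = dist-offset (2≤n bounds) t<n v≡u+t

shift-irrefl : ∀ {n s} (u : Fin n) → 0 < s → s < n → ¬ Shift n u u s
shift-irrefl u s>0 s<n (inj₁ u≡u+s) = <⇒≢ s>0 (+-cancelˡ-≡ (toℕ u) 0 _ (trans (+-identityʳ _) u≡u+s))
shift-irrefl u s>0 s<n (inj₂ u+n≡u+s) = <⇒≢ s<n (sym (+-cancelˡ-≡ (toℕ u) _ _ u+n≡u+s))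

adj-irrefl : ∀ {n} (u : Fin n) → 3 ≤ n → ¬ Adj n u u
adj-irrefl u 3≤n (inj₁ u→u)               = shift-irrefl u z<s (<-≤-trans (s≤s (s≤s z≤n)) 3≤n) u→u
adj-irrefl u 3≤n (inj₂ (inj₁ u→u))        = shift-irrefl u z<s 3≤n u→u
adj-irrefl u 3≤n (inj₂ (inj₂ (inj₁ u→u))) = shift-irrefl u z<s (<-≤-trans (s≤s (s≤s z≤n)) 3≤n) u→u
adj-irrefl u 3≤n (inj₂ (inj₂ (inj₂ u→u))) = shift-irrefl u z<s 3≤n u→u

filter-length≤1 : ∀ {A : Set} {P : A → Set} (P? : Decidable P) {xs : List A} → Unique xs →
  (∀ {x y} → P x → P y → x ≡ y) → length (filter P? xs) ≤ 1
filter-length≤1 P? {[]}     _                  _        = z≤n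
filter-length≤1 P? {x ∷ xs} (x∉xs AllPairs.∷ unique) P-unique with P? x
... | yes px = ≤-reflexive (cong (suc ∘ length)
                 (filter-none P? (All.map (λ x≢y py → x≢y (P-unique px py)) x∉xs)))
... | no _   = filter-length≤1 P? unique P-unique

singleton : ∀ {n} → Fin (suc n) → Bool
singleton Fin.zero    = true
singleton (Fin.suc _) = false

singleton-indep : ∀ {n} → 3 ≤ suc n → IsIndepSet (suc n) singleton
singleton-indep 3≤n Fin.zero    Fin.zero    _ _ = adj-irrefl Fin.zero 3≤n
singleton-indep 3≤n Fin.zero    (Fin.suc _) _ ()
singleton-indep 3≤n (Fin.suc _) _           ()

size-singleton : ∀ n → size (suc n) singleton ≡ 1
size-singleton n = cong (suc ∘ length) (filter-none (λ v → singleton {n} v Bool.≟ true) (tabulate⁺ {f = Fin.suc} λ _ ()))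

α-diam≡1 : ∀ {n} → DiamBounds n 1 → IsIndependenceNumber n 1
α-diam≡1 {zero} bounds = ⊥-elim (<⇒≱ z<s (4≤n bounds))
α-diam≡1 {suc n} bounds =
  (singleton , singleton-indep (≤-trans (s≤s (s≤s (s≤s z≤n))) (4≤n bounds)) , size-singleton n) ,
  λ S S-indep → filter-length≤1 (λ v → S v Bool.≟ true) (allFin⁺ (suc n)) (same-vertex S S-indep)
  where
  same-vertex : ∀ S → IsIndepSet (suc n) S → ∀ {u v} → S u ≡ true → S v ≡ true → u ≡ v
  same-vertex S S-indep {u} {v} Su Sv with u Fin.≟ v
  ... | yes u≡v = u≡v
  ... | no u≢v = ⊥-elim (S-indep u v Su Sv (diam≡1⇒adj bounds u≢v))

broadcast-number : ∀ {n D β} → DiamBounds n D →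
  (∃ λ f → IsBroadcast n f × IsIndependent n f × cost n f ≡ β) →
  D ≤ β → (∀ {σ} → Packing n σ → σ ≤ β) → IsBroadcastIndependenceNumber n β
broadcast-number bounds optimal D≤β packing≤β =
  optimal , λ f broadcast independent →
    [ (λ σ≤D → ≤-trans σ≤D D≤β) , packing≤β ]′ (broadcast-packing bounds broadcast independent)

β-diam≡1 : ∀ {n} → DiamBounds n 1 → IsBroadcastIndependenceNumber n 1
β-diam≡1 bounds = broadcast-number bounds
  (spaced-broadcast {k = 1} {h = 3} bounds ≤-refl (≤-trans (n≤1+n 3) (4≤n bounds)) ≤-refl)
  ≤-refl (λ p → packing-coarse p (n≤4D+1 bounds))

β-exceptional : ∀ {r D} → DiamBounds (9 + r * 12) D → IsBroadcastIndependenceNumber (9 + r * 12) (3 * suc (r + r))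
β-exceptional {r} {D} bounds = broadcast-number bounds
  (spaced-broadcast {k = 3} {h = 4 * r + 3} bounds (≤-reflexive (2c<h r)) (≤-reflexive (3h≡n r)) c≤D)
  D≤3c (λ p → packing-coarse p (≤-reflexive (n≡6c+3 r)))
  where
  c≤D : suc (r + r) ≤ D
  c≤D = *-cancelˡ-≤ 4 (+-cancelʳ-≤ 1 _ _ (≤-trans (≤-trans (m≤m+n _ (4 * r + 4)) (≤-reflexive (4c+1≤n r))) (n≤4D+1 bounds)))
    where
    4c+1≤n : ∀ r → 4 * suc (r + r) + 1 + (4 * r + 4) ≡ 9 + r * 12
    4c+1≤n = solve-∀
  D≤3c : D ≤ 3 * suc (r + r)
  D≤3c = *-cancelˡ-≤ 4 (≤-trans (4D≤n+2 bounds) (≤-trans (m≤m+n _ (r * 12 + 1)) (≤-reflexive (n+2≤12c r))))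
    where
    n+2≤12c : ∀ r → 9 + r * 12 + 2 + (r * 12 + 1) ≡ 4 * (3 * suc (r + r))
    n+2≤12c = solve-∀
  2c<h : ∀ r → suc (suc (r + r) + suc (r + r)) ≡ 4 * r + 3
  2c<h = solve-∀
  3h≡n : ∀ r → 3 * (4 * r + 3) ≡ 9 + r * 12
  3h≡n = solve-∀
  n≡6c+3 : ∀ r → 9 + r * 12 ≡ 3 * suc (r + r) + 3 * suc (r + r) + 3
  n≡6c+3 = solve-∀

β-generic : ∀ {n d} → DiamBounds n (suc (suc d)) → n % 12 ≢ 9 → IsBroadcastIndependenceNumber n (2 * suc d)
β-generic {n} {d} bounds n%12≢9 = broadcast-number bounds
  (spaced-broadcast {k = 2} {h = suc (suc (suc (d + d)))} bounds (≤-reflexive (2c<h d)) 2h≤n (n≤1+n (suc d)))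
  D≤2c (λ p → packing-fine p (n≤4D+1 bounds) n%12≢9)
  where
  2h≤n : 2 * suc (suc (suc (d + d))) ≤ n
  2h≤n = +-cancelʳ-≤ 2 _ _ (≤-trans (≤-reflexive (2h+2≡4D d)) (4D≤n+2 bounds))
    where
    2h+2≡4D : ∀ d → 2 * suc (suc (suc (d + d))) + 2 ≡ 4 * suc (suc d)
    2h+2≡4D = solve-∀
  2c<h : ∀ d → suc (suc d + suc d) ≡ suc (suc (suc (d + d)))
  2c<h = solve-∀
  D≤2c : suc (suc d) ≤ 2 * suc d
  D≤2c = ≤-trans (s≤s (m≤n+m (suc d) d)) (≤-reflexive (cong suc (cong (d +_) (sym (+-identityʳ (suc d))))))

β-n%12≡9 : ∀ {n} → 4 ≤ n → n % 12 ≡ 9 → IsBroadcastIndependenceNumber n ((n ∸ 3) / 2)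
β-n%12≡9 {n} 4≤n n%12≡9 = subst₂ IsBroadcastIndependenceNumber (sym n≡9+12r) (sym [n-3]/2≡3c)
  (β-exceptional {r} (subst (λ m → DiamBounds m ((n + 2) / 4)) n≡9+12r (diamBounds 4≤n)))
  where
  r : ℕ
  r = n / 12
  n≡9+12r : n ≡ 9 + r * 12
  n≡9+12r = trans (m≡m%n+[m/n]*n n 12) (cong (_+ r * 12) n%12≡9)
  [n-3]/2≡3c : (n ∸ 3) / 2 ≡ 3 * suc (r + r)
  [n-3]/2≡3c = begin
    (n ∸ 3) / 2                              ≡⟨ cong (λ m → (m ∸ 3) / 2) (trans n≡9+12r (9+12r≡6c+3 r)) ⟩
    (3 * suc (r + r) * 2 + 3 ∸ 3) / 2        ≡⟨ cong (_/ 2) (m+n∸n≡m (3 * suc (r + r) * 2) 3) ⟩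
    3 * suc (r + r) * 2 / 2                  ≡⟨ m*n/n≡m (3 * suc (r + r)) 2 ⟩
    3 * suc (r + r)                          ∎
    where
    open ≡-Reasoning
    9+12r≡6c+3 : ∀ r → 9 + r * 12 ≡ 3 * suc (r + r) * 2 + 3
    9+12r≡6c+3 = solve-∀

β-otherwise : ∀ {n D} → DiamBounds n D → n ≢ 4 → n ≢ 5 → n % 12 ≢ 9 →
  IsBroadcastIndependenceNumber n (2 * (D ∸ 1))
β-otherwise {D = zero}        bounds _   _   _       = ⊥-elim (<⇒≱ (2≤n bounds) (n≤4D+1 bounds))
β-otherwise {D = 1}           bounds n≢4 n≢5 _       = ⊥-elim ([ n≢4 , n≢5 ]′ (m≤n≤1+m (4≤n bounds) (n≤4D+1 bounds)))
β-otherwise {D = suc (suc d)} bounds _   _   n%12≢9 = β-generic bounds n%12≢9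

diamBounds-small : ∀ {n} → n ≡ 4 ⊎ n ≡ 5 → DiamBounds n 1
diamBounds-small (inj₁ refl) = diamBounds (s≤s (s≤s (s≤s (s≤s z≤n))))
diamBounds-small (inj₂ refl) = diamBounds (s≤s (s≤s (s≤s (s≤s z≤n))))

theorem16 : (n : ℕ) → 4 ≤ n →
    ((n ≡ 4 ⊎ n ≡ 5) → IsIndependenceNumber n 1 × IsBroadcastIndependenceNumber n 1)
    × (n % 12 ≡ 9 → IsBroadcastIndependenceNumber n ((n ∸ 3) / 2))
    × (n ≢ 4 → n ≢ 5 → n % 12 ≢ 9 →
        IsDiam n ((n + 2) / 4) × IsBroadcastIndependenceNumber n (2 * ((n + 2) / 4 ∸ 1)))
theorem16 n 4≤n =
  (λ n∈4,5 → α-diam≡1 (diamBounds-small n∈4,5) , β-diam≡1 (diamBounds-small n∈4,5)) ,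
  β-n%12≡9 4≤n ,
  λ n≢4 n≢5 n%12≢9 → isDiam (diamBounds 4≤n) , β-otherwise (diamBounds 4≤n) n≢4 n≢5 n%12≢9
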